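{- Let $\Phi = \mathcal{Q}:(A\wedge B)$ be an SSAT formula with $\mathcal{Q} = Q_1x_1\ldots Q_nx_n$, where $A$ and $B$ are in conjunctive normal form and $A\wedge B$ contains only non-tautological clauses. Let the pair $(c^p, I)$ be derivable from $\Phi$ by interpolating S-resolution, and let $\mathcal{Q}(c) = Q_1x_1\ldots Q_ix_i$. Then for each assignment $\tau:\{x_1,\dots,x_i\}\to\{\mathrm{true},\mathrm{false}\}$ with $\tau(x)=\mathrm{ff}_c(x)$ for all $x\in\mathrm{Var}(c)$: (1) $\mathrm{Var}(I)\subseteq V_{A,B}$; (2) $Pr(Q_{i+1}x_{i+1}\ldots Q_nx_n : (A\wedge\neg\mathcal{S}_{A,B}\wedge\neg I)[\tau(x_1)/x_1]\ldots[\tau(x_i)/x_i]) = 0$; (3) $Pr(Q_{i+1}x_{i+1}\ldots Q_nx_n : (I\wedge B\wedge\neg\mathcal{S}_{A,B})[\tau(x_1)/x_1]\ldots[\tau(x_i)/x_i]) = 0$.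
   Context: An SSAT formula is $\mathcal{Q} : \varphi$ where $\mathcal{Q} = Q_1x_1\ldots Q_nx_n$ is a prefix of quantified propositional variables, each $Q_i$ being either $\exists$ or a randomized quantifier $\mathsf{R}^{p_i}$ with rational $0<p_i<1$, and $\varphi$ is a propositional formula with $\mathrm{Var}(\varphi)\subseteq\{x_1,\dots,x_n\}$. Its maximum probability of satisfaction is defined recursively: $Pr(\varepsilon:\varphi)$ is $0$ if $\varphi$ is equivalent to false and $1$ if equivalent to true; $Pr(\exists x\,\mathcal{Q}':\varphi) = \max(Pr(\mathcal{Q}':\varphi[\mathrm{true}/x]),Pr(\mathcal{Q}':\varphi[\mathrm{false}/x]))$; $Pr(\mathsf{R}^p x\,\mathcal{Q}':\varphi) = p\,Pr(\mathcal{Q}':\varphi[\mathrm{true}/x]) + (1-p)\,Pr(\mathcal{Q}':\varphi[\mathrm{false}/x])$. Sets: $V_A := \mathrm{Var}(A)\setminus\mathrm{Var}(B)=\{a_1,\dots,a_\alpha\}$, $V_B := \mathrm{Var}(B)\setminus\mathrm{Var}(A)=\{b_1,\dots,b_\beta\}$, $V_{A,B}:=\mathrm{Var}(A)\cap\mathrm{Var}(B)$; $\mathcal{S}_{A,B}$ is a propositional formula over $V_{A,B}$ equivalent to $\exists a_1,\dots,a_\alpha,b_1,\dots,b_\beta:(A\wedge B)$. A clause is a disjunction (identified with a set) of literals without repetitions; tautological means valid. $\mathcal{Q}(\psi)$ is the shortest prefix $Q_1x_1\ldots Q_ix_i$ of $\mathcal{Q}$ containing all variables of $\psi$. For a non-tautological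 clause $c$, $\mathrm{ff}_c$ is the unique assignment on $\mathrm{Var}(c)$ falsifying $c$ ($\mathrm{ff}_c(x)=\mathrm{true}$ iff $\neg x\in c$). S-resolution (for $\varphi = A\wedge B$) derives annotated clauses $c^p$: (R.1) every clause $c$ of $\varphi$ gives $c^0$; (R.2) if $c$ is a non-tautological clause over variables of $\varphi$, $\mathcal{Q}(c)=Q_1x_1\ldots Q_ix_i$, and for every $\tau:\{x_1,\dots,x_i\}\to\{\mathrm{true},\mathrm{false}\}$ agreeing with $\mathrm{ff}_c$ on $\mathrm{Var}(c)$ the formula $\varphi[\tau(x_1)/x_1]\ldots[\tau(x_i)/x_i]$ is valid, derive $c^1$; (R.3) from $(c_1\vee\neg x)^{p_1}$, $(c_2\vee x)^{p_2}$, where $Qx$ is in $\mathcal{Q}$ but not in $\mathcal{Q}(c_1\vee c_2)$ and $c_1\vee c_2$ is non-tautological, derive $(c_1\vee c_2)^p$ with $p=\max(p_1,p_2)$ if $Q=\exists$, $p=p_xp_1+(1-p_x)p_2$ if $Q=\mathsf{R}^{p_x}$. Interpolating S-resolution derives pairs $(c^p, I)$ with $I$ a propositional formula: (R'.1) for a clause $c$ of $A$ derive $(c^0,\mathrm{false})$, for a clause $c$ of $B$ derive $(c^0,\mathrm{true})$; (R'.2) whenever $c^p$ is derivable by (R.2), derive $(c^p, I)$ for any propositional formula $I$ over $V_{A,B}$; (R'.3) from $((c_1\vee\neg x)^{p_1}, I_1)$ and $((c_2\vee x)^{p_2}, I_2)$ such that (R.3) yields $(c_1\vee c_2)^p$ from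 the two clauses, derive $((c_1\vee c_2)^p, I)$ where $I = I_1\vee I_2$ if $x\in V_A$, $I = I_1\wedge I_2$ if $x\in V_B$, and $I=(\neg x\vee I_1)\wedge(x\vee I_2)$ if $x\in V_{A,B}$. -}

module Defs where

open import Data.Nat as ℕ using (ℕ; zero; suc; _≤_; _<ᵇ_; _≤?_)
open import Data.Fin as Fin using (Fin; toℕ; _≟_)
open import Data.Bool using (Bool; true; false; if_then_else_; not; _∧_; _∨_)
open import Data.Maybe using (Maybe; just; nothing)
open import Data.List using (List; []; _∷_; _++_; foldr; filter; allFin)
open import Data.List.Membership.Propositional using (_∈_)
open import Data.List.Relation.Unary.Unique.Propositional using (Unique)
open import Data.Rational as ℚ using (ℚ; 0ℚ; 1ℚ)
open import Data.Product using (Σ; ∃; ∃-syntax; _×_; _,_)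
open import Data.Sum using (_⊎_)
open import Relation.Nullary using (¬_; yes; no)
open import Relation.Binary.PropositionalEquality using (_≡_; _≢_)
open import Function.Bundles using (_⇔_)

-- Quantifiers: ∃ or randomized R^p with rational 0 < p < 1.
-- The prefix Q = Q₁x₁ … Qₙxₙ is a map Fin n → Quant; the variable x_{k+1}
-- is the element of Fin n with toℕ = k, and the prefix order is the order
-- of Fin n.

data Quant : Set where
  Ex : Quant
  Rnd : (p : ℚ) → 0ℚ ℚ.< p → p ℚ.< 1ℚ → Quant

Prefix : ℕ → Set
Prefix n = Fin n → Quant

infix 8 ¬f_
infixr 7 _∧f_
infixr 6 _∨f_

data Form (n : ℕ) : Set where
  tt ff : Form n
  var   : Fin n → Form n
  ¬f_   : Form n → Form n
  _∧f_  : Form n → Form n → Form n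
  _∨f_  : Form n → Form n → Form n

Assignment : ℕ → Set
Assignment n = Fin n → Bool

eval : ∀ {n} → Assignment n → Form n → Bool
eval σ tt = true
eval σ ff = false
eval σ (var x) = σ x
eval σ (¬f φ) = not (eval σ φ)
eval σ (φ ∧f ψ) = eval σ φ ∧ eval σ ψ
eval σ (φ ∨f ψ) = eval σ φ ∨ eval σ ψ

_occursIn_ : ∀ {n} → Fin n → Form n → Set
x occursIn tt = Data.Empty.⊥ where import Data.Empty
x occursIn ff = Data.Empty.⊥ where import Data.Empty
x occursIn var y = x ≡ y
x occursIn (¬f φ) = x occursIn φ
x occursIn (φ ∧f ψ) = x occursIn φ ⊎ x occursIn ψ
x occursIn (φ ∨f ψ) = x occursIn φ ⊎ x occursIn ψ

substF : ∀ {n} → (Fin n → Maybe Bool) → Form n → Form n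
substF s tt = tt
substF s ff = ff
substF s (var x) with s x
... | just true  = tt
... | just false = ff
... | nothing    = var x
substF s (¬f φ) = ¬f substF s φ
substF s (φ ∧f ψ) = substF s φ ∧f substF s ψ
substF s (φ ∨f ψ) = substF s φ ∨f substF s ψ

_[_/_] : ∀ {n} → Form n → Bool → Fin n → Form n
φ [ b / x ] = substF (λ y → if Relation.Nullary.does (y ≟ x) then just b else nothing) φ
  where import Relation.Nullary

-- φ[τ(x₁)/x₁]…[τ(xᵢ)/xᵢ]  (only the values of τ on x₁ … xᵢ are used)
substPrefix : ∀ {n} → ℕ → Assignment n → Form n → Form n
substPrefix i τ = substF (λ y → if toℕ y <ᵇ i then just (τ y) else nothing)

Valid : ∀ {n} → Form n → Set
Valid φ = ∀ σ → eval σ φ ≡ true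

-- Maximum probability of satisfaction Pr(Q' : φ), where the prefix Q' is
-- given as a list of variables (in prefix order) with quantifiers taken from
-- the global prefix.  For the empty prefix, φ is variable-free (in all uses
-- below), so its truth value is computed by evaluation under an arbitrary
-- assignment (here: all false); it is 1 if φ ≡ true and 0 if φ ≡ false.

Pr : ∀ {n} → Prefix n → List (Fin n) → Form n → ℚ
Pr Q [] φ = if eval (λ _ → false) φ then 1ℚ else 0ℚ
Pr Q (x ∷ xs) φ with Q x
... | Ex = Pr Q xs (φ [ true / x ]) ℚ.⊔ Pr Q xs (φ [ false / x ])
... | Rnd p _ _ = (p ℚ.* Pr Q xs (φ [ true / x ]))
                  ℚ.+ ((1ℚ ℚ.- p) ℚ.* Pr Q xs (φ [ false / x ]))

suffixVars : ∀ n → ℕ → List (Fin n)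
suffixVars n i = filter (λ j → i ≤? toℕ j) (allFin n)

data Lit (n : ℕ) : Set where
  pos neg : Fin n → Lit n

litVar : ∀ {n} → Lit n → Fin n
litVar (pos x) = x
litVar (neg x) = x

-- clauses are lists of literals; "without repetitions" is imposed via Unique
-- wherever clauses are introduced.  Clauses are identified with sets: all
-- notions below depend only on the membership relation.
Clause : ℕ → Set
Clause n = List (Lit n)

CNF : ℕ → Set
CNF n = List (Clause n)

litF : ∀ {n} → Lit n → Form n
litF (pos x) = var x
litF (neg x) = ¬f var x

clauseF : ∀ {n} → Clause n → Form n
clauseF = foldr (λ l φ → litF l ∨f φ) ff

cnfF : ∀ {n} → CNF n → Form n
cnfF = foldr (λ c φ → clauseF c ∧f φ) tt

Tautological : ∀ {n} → Clause n → Set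
Tautological c = Valid (clauseF c)

_∈VarC_ : ∀ {n} → Fin n → Clause n → Set
x ∈VarC c = ∃[ l ] (l ∈ c × litVar l ≡ x)

_∈Var_ : ∀ {n} → Fin n → CNF n → Set
x ∈Var F = ∃[ c ] (c ∈ F × x ∈VarC c)

module Sets {n : ℕ} (A B : CNF n) where
  VA VB VAB : Fin n → Set
  VA x = x ∈Var A × ¬ (x ∈Var B)
  VB x = x ∈Var B × ¬ (x ∈Var A)
  VAB x = x ∈Var A × x ∈Var B

  -- S is a formula over V_{A,B} equivalent to ∃ a₁…a_α b₁…b_β : (A ∧ B)
  IsSAB : Form n → Set
  IsSAB S = (∀ x → x occursIn S → VAB x)
          × (∀ σ → (eval σ S ≡ true) ⇔
                   (∃[ σ' ] ((∀ x → ¬ VA x → ¬ VB x → σ' x ≡ σ x)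
                             × eval σ' (cnfF A ∧f cnfF B) ≡ true)))
open Sets public

-- length i of the shortest prefix Q(c) = Q₁x₁…Qᵢxᵢ containing all vars of c
qlen : ∀ {n} → Clause n → ℕ
qlen = foldr (λ l m → suc (toℕ (litVar l)) ℕ.⊔ m) 0

-- τ agrees with ff_c on Var(c):  ff_c(x) = true iff ¬x ∈ c
AgreesFF : ∀ {n} → Assignment n → Clause n → Set
AgreesFF τ c = ∀ x → x ∈VarC c → ((τ x ≡ true) ⇔ (neg x ∈ c))

module _ {n : ℕ} (Q : Prefix n) (A B : CNF n) where

  φAB : Form n
  φAB = cnfF A ∧f cnfF B

  R2Cond : Clause n → Set
  R2Cond c = Unique c × ¬ Tautological c
           × (∀ x → x ∈VarC c → x ∈Var A ⊎ x ∈Var B)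
           × (∀ (τ : Assignment n) → AgreesFF τ c → Valid (substPrefix (qlen c) τ φAB))

  -- r is the resolvent c₁ ∨ c₂ of d₁ = c₁ ∨ ¬x and d₂ = c₂ ∨ x  (rule R.3):
  -- r is a non-tautological clause (without repetitions) whose literals are
  -- those of d₁ other than ¬x and those of d₂ other than x, and Qx is not in
  -- Q(r).
  Resolvent : Clause n → Clause n → Fin n → Clause n → Set
  Resolvent d₁ d₂ x r = neg x ∈ d₁ × pos x ∈ d₂
    × (∀ l → (l ∈ r) ⇔ ((l ∈ d₁ × l ≢ neg x) ⊎ (l ∈ d₂ × l ≢ pos x)))
    × Unique r × ¬ Tautological r
    × qlen r ≤ toℕ x

  resProb : Quant → ℚ → ℚ → ℚ
  resProb Ex p₁ p₂ = p₁ ℚ.⊔ p₂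
  resProb (Rnd px _ _) p₁ p₂ = (px ℚ.* p₁) ℚ.+ ((1ℚ ℚ.- px) ℚ.* p₂)

  data Derivable : Clause n → ℚ → Form n → Set where
    axA : ∀ {c} → c ∈ A → Derivable c 0ℚ ff
    axB : ∀ {c} → c ∈ B → Derivable c 0ℚ tt
    r2  : ∀ {c I} → R2Cond c → (∀ x → x occursIn I → VAB A B x) → Derivable c 1ℚ I
    resA : ∀ {d₁ d₂ x r p₁ p₂ I₁ I₂} → Derivable d₁ p₁ I₁ → Derivable d₂ p₂ I₂
         → Resolvent d₁ d₂ x r → VA A B x
         → Derivable r (resProb (Q x) p₁ p₂) (I₁ ∨f I₂)
    resB : ∀ {d₁ d₂ x r p₁ p₂ I₁ I₂} → Derivable d₁ p₁ I₁ → Derivable d₂ p₂ I₂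
         → Resolvent d₁ d₂ x r → VB A B x
         → Derivable r (resProb (Q x) p₁ p₂) (I₁ ∧f I₂)
    resAB : ∀ {d₁ d₂ x r p₁ p₂ I₁ I₂} → Derivable d₁ p₁ I₁ → Derivable d₂ p₂ I₂
         → Resolvent d₁ d₂ x r → VAB A B x
         → Derivable r (resProb (Q x) p₁ p₂) ((¬f var x ∨f I₁) ∧f (var x ∨f I₂))

-- Every derivable pair (c, I) is an
-- interpolant relative to the falsifying assignments of c: for each σ with
-- σ ⊭ c, A ∧ ¬S entails I and I ∧ B entails S at σ.  This is proved by
-- induction on the derivation; at a resolution step σ falsifies the premise
-- selected by σ(x), and the other premise is reached by flipping the pivot x,
-- which is harmless on every formula not mentioning x.  Fixing the prefix
-- variables by τ falsifies c (c is not tautological and its variables lie in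
-- the prefix), so both formulas of the theorem become unsatisfiable, and an
-- unsatisfiable formula has maximum probability 0 under any prefix.
module Submission where

open import Defs
open import Data.Nat using (ℕ; suc; _<_; _<ᵇ_)
open import Data.Nat.Properties using (m≤m⊔n; m≤n⊔m; ≤-trans; <-≤-trans; <⇒≢; <⇒<ᵇ)
open import Data.Fin using (Fin; toℕ; _≟_)
open import Data.Bool using (Bool; true; false; not; _∧_; _∨_; if_then_else_)
open import Data.Bool.Properties using (∨-zeroʳ; ∧-zeroʳ; ∧-identityʳ; not-injective)
open import Data.Maybe using (Maybe; just; nothing; fromMaybe)
open import Data.List using ([]; _∷_; _++_)
open import Data.List.Membership.Propositional using (_∈_)
open import Data.List.Membership.Propositional.Properties using (∈-++⁺ˡ; ∈-++⁺ʳ)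
open import Data.List.Relation.Unary.Any using (here; there)
open import Data.List.Relation.Unary.Unique.Propositional using (Unique)
open import Data.Rational using (ℚ; 0ℚ; 1ℚ; _+_; _*_; _-_)
open import Data.Rational.Properties using (*-zeroʳ; +-identityʳ)
open import Data.Vec.Functional using (updateAt)
open import Data.Vec.Functional.Properties using (updateAt-updates; updateAt-minimal)
open import Data.Product using (_×_; _,_; proj₁; proj₂)
open import Data.Sum using (_⊎_; inj₁; inj₂; [_,_]′)
open import Function using (const; _∘_)
open import Function.Bundles using (Equivalence; mk⇔)
open import Relation.Nullary using (¬_; does; yes; no; contradiction)
open import Relation.Binary.PropositionalEquality
  using (_≡_; _≢_; refl; sym; trans; cong; cong₂; module ≡-Reasoning)

private
  variable
    n : ℕ
    σ τ : Assignment n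
    φ I I₁ I₂ : Form n
    x y : Fin n
    b : Bool
    l : Lit n
    c d₁ d₂ r : Clause n
    p : ℚ

∧-≡-true : ∀ {u v} → u ∧ v ≡ true → u ≡ true × v ≡ true
∧-≡-true {true} {true} refl = refl , refl

∨-≡-true : ∀ {u v} → u ∨ v ≡ true → u ≡ true ⊎ v ≡ true
∨-≡-true {true} refl = inj₁ refl
∨-≡-true {false} refl = inj₂ refl

pivot-true : ∀ {v} u w → v ≡ true → (not v ∨ u) ∧ (v ∨ w) ≡ u
pivot-true u w refl = ∧-identityʳ u

pivot-false : ∀ {v} u w → v ≡ false → (not v ∨ u) ∧ (v ∨ w) ≡ w
pivot-false u w refl = refl

∧-not-∧-not-≡-false : ∀ u v w → (u ≡ true → v ≡ false → w ≡ true) → (u ∧ not v) ∧ not w ≡ false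
∧-not-∧-not-≡-false false v w _ = refl
∧-not-∧-not-≡-false true true w _ = refl
∧-not-∧-not-≡-false true false w h rewrite h refl refl = refl

∧-∧-not-≡-false : ∀ u v w → (u ≡ true → v ≡ true → w ≡ true) → (u ∧ v) ∧ not w ≡ false
∧-∧-not-≡-false false v w _ = refl
∧-∧-not-≡-false true false w _ = refl
∧-∧-not-≡-false true true w h rewrite h refl refl = refl

override : (Fin n → Maybe Bool) → Assignment n → Assignment n
override s σ y = fromMaybe (σ y) (s y)

eval-substF : ∀ (s : Fin n → Maybe Bool) σ φ → eval σ (substF s φ) ≡ eval (override s σ) φ
eval-substF s σ tt = refl
eval-substF s σ ff = refl
eval-substF s σ (var x) with s x
... | just true = refl
... | just false = refl
... | nothing = refl
eval-substF s σ (¬f φ) = cong not (eval-substF s σ φ)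
eval-substF s σ (φ ∧f ψ) = cong₂ _∧_ (eval-substF s σ φ) (eval-substF s σ ψ)
eval-substF s σ (φ ∨f ψ) = cong₂ _∨_ (eval-substF s σ φ) (eval-substF s σ ψ)

eval-local : ∀ φ → (∀ y → y occursIn φ → σ y ≡ τ y) → eval σ φ ≡ eval τ φ
eval-local tt _ = refl
eval-local ff _ = refl
eval-local (var x) agree = agree x refl
eval-local (¬f φ) agree = cong not (eval-local φ agree)
eval-local (φ ∧f ψ) agree =
  cong₂ _∧_ (eval-local φ (λ y → agree y ∘ inj₁)) (eval-local ψ (λ y → agree y ∘ inj₂))
eval-local (φ ∨f ψ) agree =
  cong₂ _∨_ (eval-local φ (λ y → agree y ∘ inj₁)) (eval-local ψ (λ y → agree y ∘ inj₂))

_[_↦_] : Assignment n → Fin n → Bool → Assignment n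
σ [ x ↦ b ] = updateAt σ x (const b)

eval-update-absent : ∀ φ → ¬ x occursIn φ → eval (σ [ x ↦ b ]) φ ≡ eval σ φ
eval-update-absent {x = x} {σ = σ} φ x∉φ =
  eval-local φ (λ y y∈φ → updateAt-minimal y x σ (λ { refl → x∉φ y∈φ }))

prefixSubst : ℕ → Assignment n → Fin n → Maybe Bool
prefixSubst i τ y = if toℕ y <ᵇ i then just (τ y) else nothing

override-prefixSubst : ∀ i τ σ → toℕ y < i → override (prefixSubst i τ) σ y ≡ τ y
override-prefixSubst {y = y} i τ σ y<i with toℕ y <ᵇ i | <⇒<ᵇ y<i
... | true | _ = refl

override-prefixSubst-self : ∀ i σ (y : Fin n) → override (prefixSubst i σ) σ y ≡ σ y
override-prefixSubst-self i σ y with toℕ y <ᵇ i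
... | true = refl
... | false = refl

Unsatisfiable : Form n → Set
Unsatisfiable {n} φ = (σ : Assignment n) → eval σ φ ≡ false

unsatisfiable-[/] : ∀ (φ : Form n) x b → Unsatisfiable φ → Unsatisfiable (φ [ b / x ])
unsatisfiable-[/] φ x b unsat σ =
  trans (eval-substF (λ y → if does (y ≟ x) then just b else nothing) σ φ) (unsat _)

Pr-unsatisfiable : ∀ (Q : Prefix n) xs (φ : Form n) → Unsatisfiable φ → Pr Q xs φ ≡ 0ℚ
Pr-unsatisfiable Q [] φ unsat rewrite unsat (const false) = refl
Pr-unsatisfiable Q (x ∷ xs) φ unsat with Q x
... | Ex rewrite Pr-unsatisfiable Q xs (φ [ true / x ]) (unsatisfiable-[/] φ x true unsat)
               | Pr-unsatisfiable Q xs (φ [ false / x ]) (unsatisfiable-[/] φ x false unsat) = refl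
... | Rnd p _ _ rewrite Pr-unsatisfiable Q xs (φ [ true / x ]) (unsatisfiable-[/] φ x true unsat)
                      | Pr-unsatisfiable Q xs (φ [ false / x ]) (unsatisfiable-[/] φ x false unsat) = begin
  p * 0ℚ + (1ℚ - p) * 0ℚ  ≡⟨ cong₂ _+_ (*-zeroʳ p) (*-zeroʳ (1ℚ - p)) ⟩
  0ℚ + 0ℚ                 ≡⟨ +-identityʳ 0ℚ ⟩
  0ℚ                      ∎
  where open ≡-Reasoning

Falsifies : Assignment n → Clause n → Set
Falsifies σ c = ∀ {l} → l ∈ c → eval σ (litF l) ≡ false

occursIn-litF : ∀ l → y occursIn litF l → y ≡ litVar l
occursIn-litF (pos x) y≡x = y≡x
occursIn-litF (neg x) y≡x = y≡x

occursIn-clauseF : ∀ c → y occursIn clauseF c → y ∈VarC c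
occursIn-clauseF (l ∷ c) (inj₁ y∈l) = l , here refl , sym (occursIn-litF l y∈l)
occursIn-clauseF (l ∷ c) (inj₂ y∈c) with occursIn-clauseF c y∈c
... | l′ , l′∈c , l′≡y = l′ , there l′∈c , l′≡y

occursIn-cnfF : ∀ F → y occursIn cnfF F → y ∈Var F
occursIn-cnfF (c ∷ F) (inj₁ y∈c) = c , here refl , occursIn-clauseF c y∈c
occursIn-cnfF (c ∷ F) (inj₂ y∈F) with occursIn-cnfF F y∈F
... | c′ , c′∈F , y∈c′ = c′ , there c′∈F , y∈c′

litVar<qlen : l ∈ c → toℕ (litVar l) < qlen c
litVar<qlen {l = l} {c = _ ∷ c} (here refl) = m≤m⊔n _ (qlen c)
litVar<qlen {c = l′ ∷ c} (there l∈c) = ≤-trans (litVar<qlen l∈c) (m≤n⊔m (suc (toℕ (litVar l′))) (qlen c))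

clauseF-false : ∀ c → Falsifies σ c → eval σ (clauseF c) ≡ false
clauseF-false [] _ = refl
clauseF-false (l ∷ c) falsified = cong₂ _∨_ (falsified (here refl)) (clauseF-false c (falsified ∘ there))

cnfF-false : ∀ F → c ∈ F → Falsifies σ c → eval σ (cnfF F) ≡ false
cnfF-false (c ∷ F) (here refl) falsified = cong (_∧ _) (clauseF-false c falsified)
cnfF-false {σ = σ} (c′ ∷ F) (there c∈F) falsified =
  trans (cong (eval σ (clauseF c′) ∧_) (cnfF-false F c∈F falsified)) (∧-zeroʳ _)

clauseF-true : l ∈ c → eval σ (litF l) ≡ true → eval σ (clauseF c) ≡ true
clauseF-true (here refl) l-true = cong (_∨ _) l-true
clauseF-true {c = l′ ∷ c} {σ = σ} (there l∈c) l-true =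
  trans (cong (eval σ (litF l′) ∨_) (clauseF-true l∈c l-true)) (∨-zeroʳ _)

complementary⇒tautological : pos y ∈ c → neg y ∈ c → Tautological c
complementary⇒tautological {y = y} y∈c ¬y∈c σ with σ y in σy
... | true = clauseF-true y∈c σy
... | false = clauseF-true ¬y∈c (cong not σy)

agreesFF⇒falsifies : ¬ Tautological c → AgreesFF τ c → Falsifies τ c
agreesFF⇒falsifies {τ = τ} non-taut agrees {pos y} y∈c with τ y in τy
... | false = refl
... | true = contradiction
  (complementary⇒tautological y∈c (Equivalence.to (agrees y (pos y , y∈c , refl)) τy)) non-taut
agreesFF⇒falsifies non-taut agrees {neg y} ¬y∈c =
  cong not (Equivalence.from (agrees y (neg y , ¬y∈c , refl)) ¬y∈c)

falsifies⇒agreesFF : Falsifies σ c → AgreesFF σ c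
falsifies⇒agreesFF {σ = σ} {c = c} falsified x (l , l∈c , refl) =
  mk⇔ (to l∈c) (λ ¬x∈c → not-injective (falsified ¬x∈c))
  where
  to : ∀ {l} → l ∈ c → σ (litVar l) ≡ true → neg (litVar l) ∈ c
  to {pos x} x∈c σx = contradiction (trans (sym σx) (falsified x∈c)) λ ()
  to {neg x} ¬x∈c _ = ¬x∈c

falsifies-prefix : ∀ (c : Clause n) (τ σ : Assignment n)
                 → Falsifies τ c → Falsifies (override (prefixSubst (qlen c) τ) σ) c
falsifies-prefix c τ σ falsified {pos y} y∈c =
  trans (override-prefixSubst (qlen c) τ σ (litVar<qlen y∈c)) (falsified y∈c)
falsifies-prefix c τ σ falsified {neg y} ¬y∈c =
  trans (cong not (override-prefixSubst (qlen c) τ σ (litVar<qlen ¬y∈c))) (falsified ¬y∈c)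

substPrefix-unsatisfiable : ∀ (c : Clause n) (φ : Form n) τ → Falsifies τ c
  → (∀ {σ} → Falsifies σ c → eval σ φ ≡ false) → Unsatisfiable (substPrefix (qlen c) τ φ)
substPrefix-unsatisfiable c φ τ falsified refutes σ =
  trans (eval-substF (prefixSubst (qlen c) τ) σ φ) (refutes (falsifies-prefix c τ σ falsified))

module Resolution {n} (Q : Prefix n) (A B : CNF n) where

  pivot∉resolvent : Resolvent Q A B d₁ d₂ x r → l ∈ r → litVar l ≢ x
  pivot∉resolvent (_ , _ , _ , _ , _ , qlen≤x) l∈r l≡x =
    <⇒≢ (<-≤-trans (litVar<qlen l∈r) qlen≤x) (cong toℕ l≡x)

  falsifies-update : Resolvent Q A B d₁ d₂ x r → Falsifies σ r → Falsifies (σ [ x ↦ b ]) r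
  falsifies-update R falsified {l} l∈r =
    trans (eval-update-absent (litF l) (pivot∉resolvent R l∈r ∘ sym ∘ occursIn-litF l)) (falsified l∈r)

  falsifies-premise₁ : Resolvent Q A B d₁ d₂ x r → Falsifies σ r → σ x ≡ true → Falsifies σ d₁
  falsifies-premise₁ (_ , _ , r⇔ , _) falsified _ {pos y} y∈d₁ =
    falsified (Equivalence.from (r⇔ (pos y)) (inj₁ (y∈d₁ , λ ())))
  falsifies-premise₁ {x = x} (_ , _ , r⇔ , _) falsified σx {neg y} ¬y∈d₁ with y ≟ x
  ... | yes refl = cong not σx
  ... | no y≢x = falsified (Equivalence.from (r⇔ (neg y)) (inj₁ (¬y∈d₁ , λ { refl → y≢x refl })))

  falsifies-premise₂ : Resolvent Q A B d₁ d₂ x r → Falsifies σ r → σ x ≡ false → Falsifies σ d₂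
  falsifies-premise₂ (_ , _ , r⇔ , _) falsified _ {neg y} ¬y∈d₂ =
    falsified (Equivalence.from (r⇔ (neg y)) (inj₂ (¬y∈d₂ , λ ())))
  falsifies-premise₂ {x = x} (_ , _ , r⇔ , _) falsified σx {pos y} y∈d₂ with y ≟ x
  ... | yes refl = σx
  ... | no y≢x = falsified (Equivalence.from (r⇔ (pos y)) (inj₂ (y∈d₂ , λ { refl → y≢x refl })))

  falsified-premise : Resolvent Q A B d₁ d₂ x r → Falsifies σ r
                    → (σ x ≡ true × Falsifies σ d₁) ⊎ (σ x ≡ false × Falsifies σ d₂)
  falsified-premise {x = x} {σ = σ} R falsified with σ x in σx
  ... | true = inj₁ (refl , falsifies-premise₁ R falsified σx)
  ... | false = inj₂ (refl , falsifies-premise₂ R falsified σx)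

  update-falsifies-premise₁ : Resolvent Q A B d₁ d₂ x r → Falsifies σ r → Falsifies (σ [ x ↦ true ]) d₁
  update-falsifies-premise₁ {x = x} {σ = σ} R falsified =
    falsifies-premise₁ R (falsifies-update R falsified) (updateAt-updates x σ)

  update-falsifies-premise₂ : Resolvent Q A B d₁ d₂ x r → Falsifies σ r → Falsifies (σ [ x ↦ false ]) d₂
  update-falsifies-premise₂ {x = x} {σ = σ} R falsified =
    falsifies-premise₂ R (falsifies-update R falsified) (updateAt-updates x σ)

derivable⇒non-tautological : ∀ {Q : Prefix n} {A B : CNF n} → (∀ c → c ∈ A ++ B → ¬ Tautological c)
                           → Derivable Q A B c p I → ¬ Tautological c
derivable⇒non-tautological non-taut (axA c∈A) = non-taut _ (∈-++⁺ˡ c∈A)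
derivable⇒non-tautological {A = A} non-taut (axB c∈B) = non-taut _ (∈-++⁺ʳ A c∈B)
derivable⇒non-tautological _ (r2 (_ , non-taut , _) _) = non-taut
derivable⇒non-tautological _ (resA _ _ (_ , _ , _ , _ , non-taut , _) _) = non-taut
derivable⇒non-tautological _ (resB _ _ (_ , _ , _ , _ , non-taut , _) _) = non-taut
derivable⇒non-tautological _ (resAB _ _ (_ , _ , _ , _ , non-taut , _) _) = non-taut

module Interpolation {n} (Q : Prefix n) (A B : CNF n) (S : Form n) (S-spec : IsSAB A B S) where
  open Resolution Q A B

  Shared : Form n → Set
  Shared φ = ∀ y → y occursIn φ → VAB A B y

  derivable⇒shared : Derivable Q A B c p I → Shared I
  derivable⇒shared (axA _) _ ()
  derivable⇒shared (axB _) _ ()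
  derivable⇒shared (r2 _ shared) = shared
  derivable⇒shared (resA D₁ D₂ _ _) y = [ derivable⇒shared D₁ y , derivable⇒shared D₂ y ]′
  derivable⇒shared (resB D₁ D₂ _ _) y = [ derivable⇒shared D₁ y , derivable⇒shared D₂ y ]′
  derivable⇒shared (resAB D₁ D₂ _ x∈VAB) y =
    [ [ pivot-shared , derivable⇒shared D₁ y ]′ , [ pivot-shared , derivable⇒shared D₂ y ]′ ]′
    where
    pivot-shared : y ≡ _ → VAB A B y
    pivot-shared refl = x∈VAB

  record Separates (σ : Assignment n) (I : Form n) : Set where
    field
      A∧¬S⇒I : eval σ (cnfF A) ≡ true → eval σ S ≡ false → eval σ I ≡ true
      I∧B⇒S : eval σ I ≡ true → eval σ (cnfF B) ≡ true → eval σ S ≡ true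
  open Separates

  Separating : Clause n → Form n → Set
  Separating c I = ∀ {σ : Assignment n} → Falsifies σ c → Separates σ I

  separates-≡ : eval σ I ≡ eval σ I₁ → Separates σ I₁ → Separates σ I
  A∧¬S⇒I (separates-≡ I≡I₁ sep) A-true S-false = trans I≡I₁ (A∧¬S⇒I sep A-true S-false)
  I∧B⇒S (separates-≡ I≡I₁ sep) I-true = I∧B⇒S sep (trans (sym I≡I₁) I-true)

  A∧¬S∧¬I-false : Separates σ I → eval σ ((cnfF A ∧f ¬f S) ∧f ¬f I) ≡ false
  A∧¬S∧¬I-false sep = ∧-not-∧-not-≡-false _ _ _ (A∧¬S⇒I sep)

  I∧B∧¬S-false : Separates σ I → eval σ ((I ∧f cnfF B) ∧f ¬f S) ≡ false
  I∧B∧¬S-false sep = ∧-∧-not-≡-false _ _ _ (I∧B⇒S sep)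

  VA⇒∉Shared : ∀ φ → VA A B x → Shared φ → ¬ x occursIn φ
  VA⇒∉Shared _ (_ , x∉B) shared = x∉B ∘ proj₂ ∘ shared _

  VB⇒∉Shared : ∀ φ → VB A B x → Shared φ → ¬ x occursIn φ
  VB⇒∉Shared _ (_ , x∉A) shared = x∉A ∘ proj₁ ∘ shared _

  A∧¬S⇒I-update : VB A B x → Shared I → Separates (σ [ x ↦ b ]) I
                → eval σ (cnfF A) ≡ true → eval σ S ≡ false → eval σ I ≡ true
  A∧¬S⇒I-update {I = I} x∈VB shared sep A-true S-false =
    trans (sym (eval-update-absent I (VB⇒∉Shared I x∈VB shared)))
      (A∧¬S⇒I sep (trans (eval-update-absent (cnfF A) (proj₂ x∈VB ∘ occursIn-cnfF A)) A-true)
                  (trans (eval-update-absent S (VB⇒∉Shared S x∈VB (proj₁ S-spec))) S-false))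

  I∧B⇒S-update : VA A B x → Shared I → Separates (σ [ x ↦ b ]) I
               → eval σ I ≡ true → eval σ (cnfF B) ≡ true → eval σ S ≡ true
  I∧B⇒S-update {I = I} x∈VA shared sep I-true B-true =
    trans (sym (eval-update-absent S (VA⇒∉Shared S x∈VA (proj₁ S-spec))))
      (I∧B⇒S sep (trans (eval-update-absent I (VA⇒∉Shared I x∈VA shared)) I-true)
                 (trans (eval-update-absent (cnfF B) (proj₂ x∈VA ∘ occursIn-cnfF B)) B-true))

  axiomA-separates : c ∈ A → Falsifies σ c → Separates σ ff
  A∧¬S⇒I (axiomA-separates c∈A falsified) A-true _ = trans (sym (cnfF-false A c∈A falsified)) A-true
  I∧B⇒S (axiomA-separates c∈A falsified) ()

  axiomB-separates : c ∈ B → Falsifies σ c → Separates σ tt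
  A∧¬S⇒I (axiomB-separates c∈B falsified) _ _ = refl
  I∧B⇒S (axiomB-separates c∈B falsified) _ B-true =
    contradiction (trans (sym B-true) (cnfF-false B c∈B falsified)) λ ()

  S-true⇒separates : eval σ S ≡ true → Separates σ I
  A∧¬S⇒I (S-true⇒separates S-true) _ S-false = contradiction (trans (sym S-true) S-false) λ ()
  I∧B⇒S (S-true⇒separates S-true) _ _ = S-true

  R2Cond⇒S-true : R2Cond Q A B c → Falsifies σ c → eval σ S ≡ true
  R2Cond⇒S-true {c = c} {σ = σ} (_ , _ , _ , valid) falsified =
    Equivalence.from (proj₂ S-spec σ) (σ , (λ _ _ _ → refl) , A∧B-true)
    where
    open ≡-Reasoning
    A∧B-true : eval σ (φAB Q A B) ≡ true
    A∧B-true = begin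
      eval σ (φAB Q A B)
        ≡⟨ eval-local (φAB Q A B) (λ y _ → override-prefixSubst-self (qlen c) σ y) ⟨
      eval (override (prefixSubst (qlen c) σ) σ) (φAB Q A B)
        ≡⟨ eval-substF (prefixSubst (qlen c) σ) σ (φAB Q A B) ⟨
      eval σ (substPrefix (qlen c) σ (φAB Q A B))
        ≡⟨ valid σ (falsifies⇒agreesFF falsified) σ ⟩
      true ∎

  resolveA-separates : Resolvent Q A B d₁ d₂ x r → VA A B x → Shared I₁ → Shared I₂
                     → Separating d₁ I₁ → Separating d₂ I₂
                     → Falsifies σ r → Separates σ (I₁ ∨f I₂)
  A∧¬S⇒I (resolveA-separates R _ _ _ sep₁ sep₂ falsified) A-true S-false
    with falsified-premise R falsified
  ... | inj₁ (_ , falsified₁) = cong (_∨ _) (A∧¬S⇒I (sep₁ falsified₁) A-true S-false)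
  ... | inj₂ (_ , falsified₂) = trans (cong (_ ∨_) (A∧¬S⇒I (sep₂ falsified₂) A-true S-false)) (∨-zeroʳ _)
  I∧B⇒S (resolveA-separates R x∈VA shared₁ shared₂ sep₁ sep₂ falsified) I-true B-true
    with ∨-≡-true I-true
  ... | inj₁ I₁-true = I∧B⇒S-update x∈VA shared₁ (sep₁ (update-falsifies-premise₁ R falsified)) I₁-true B-true
  ... | inj₂ I₂-true = I∧B⇒S-update x∈VA shared₂ (sep₂ (update-falsifies-premise₂ R falsified)) I₂-true B-true

  resolveB-separates : Resolvent Q A B d₁ d₂ x r → VB A B x → Shared I₁ → Shared I₂
                     → Separating d₁ I₁ → Separating d₂ I₂
                     → Falsifies σ r → Separates σ (I₁ ∧f I₂)
  A∧¬S⇒I (resolveB-separates R x∈VB shared₁ shared₂ sep₁ sep₂ falsified) A-true S-false =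
    cong₂ _∧_ (A∧¬S⇒I-update x∈VB shared₁ (sep₁ (update-falsifies-premise₁ R falsified)) A-true S-false)
              (A∧¬S⇒I-update x∈VB shared₂ (sep₂ (update-falsifies-premise₂ R falsified)) A-true S-false)
  I∧B⇒S (resolveB-separates R _ _ _ sep₁ sep₂ falsified) I-true B-true
    with falsified-premise R falsified
  ... | inj₁ (_ , falsified₁) = I∧B⇒S (sep₁ falsified₁) (proj₁ (∧-≡-true I-true)) B-true
  ... | inj₂ (_ , falsified₂) = I∧B⇒S (sep₂ falsified₂) (proj₂ (∧-≡-true I-true)) B-true

  resolveAB-separates : Resolvent Q A B d₁ d₂ x r → Separating d₁ I₁ → Separating d₂ I₂
                      → Falsifies σ r → Separates σ ((¬f var x ∨f I₁) ∧f (var x ∨f I₂))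
  resolveAB-separates R sep₁ sep₂ falsified with falsified-premise R falsified
  ... | inj₁ (σx , falsified₁) = separates-≡ (pivot-true _ _ σx) (sep₁ falsified₁)
  ... | inj₂ (σx , falsified₂) = separates-≡ (pivot-false _ _ σx) (sep₂ falsified₂)

  derivable⇒separating : Derivable Q A B c p I → Separating c I
  derivable⇒separating (axA c∈A) = axiomA-separates c∈A
  derivable⇒separating (axB c∈B) = axiomB-separates c∈B
  derivable⇒separating (r2 cond _) = S-true⇒separates ∘ R2Cond⇒S-true cond
  derivable⇒separating (resA D₁ D₂ R x∈VA) = resolveA-separates R x∈VA
    (derivable⇒shared D₁) (derivable⇒shared D₂) (derivable⇒separating D₁) (derivable⇒separating D₂)
  derivable⇒separating (resB D₁ D₂ R x∈VB) = resolveB-separates R x∈VB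
    (derivable⇒shared D₁) (derivable⇒shared D₂) (derivable⇒separating D₁) (derivable⇒separating D₂)
  derivable⇒separating (resAB D₁ D₂ R _) =
    resolveAB-separates R (derivable⇒separating D₁) (derivable⇒separating D₂)

lemma3p4 : ∀ {n} (Q : Prefix n) (A B : CNF n)
    → (∀ c → c ∈ A ++ B → Unique c)
    → (∀ c → c ∈ A ++ B → ¬ Tautological c)
    → (S : Form n) → IsSAB A B S
    → ∀ {c p I} → Derivable Q A B c p I
    → ∀ (τ : Assignment n) → AgreesFF τ c
    → (∀ x → x occursIn I → VAB A B x)
      × Pr Q (suffixVars n (qlen c)) (substPrefix (qlen c) τ ((cnfF A ∧f ¬f S) ∧f ¬f I)) ≡ 0ℚ
      × Pr Q (suffixVars n (qlen c)) (substPrefix (qlen c) τ ((I ∧f cnfF B) ∧f ¬f S)) ≡ 0ℚ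
lemma3p4 {n} Q A B _ non-taut S S-spec {c} {I = I} derivation τ agrees =
  derivable⇒shared derivation ,
  Pr-zero ((cnfF A ∧f ¬f S) ∧f ¬f I) (A∧¬S∧¬I-false ∘ derivable⇒separating derivation) ,
  Pr-zero ((I ∧f cnfF B) ∧f ¬f S) (I∧B∧¬S-false ∘ derivable⇒separating derivation)
  where
  open Interpolation Q A B S S-spec
  τ-falsifies : Falsifies τ c
  τ-falsifies = agreesFF⇒falsifies (derivable⇒non-tautological non-taut derivation) agrees
  Pr-zero : ∀ φ → (∀ {σ} → Falsifies σ c → eval σ φ ≡ false)
          → Pr Q (suffixVars n (qlen c)) (substPrefix (qlen c) τ φ) ≡ 0ℚ
  Pr-zero φ refutes = Pr-unsatisfiable Q (suffixVars n (qlen c)) (substPrefix (qlen c) τ φ)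
    (substPrefix-unsatisfiable c φ τ τ-falsifies refutes)
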